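{- Let $[9,00]$ be the two-vertex Boolean network $f_1=x_1$, $f_2=x_1\land\neg x_2$, and $[20,00]$ the network $f_1=\neg x_1\land x_2$, $f_2=x_2$. For every delay vector $(\alpha,\beta)$, the MBN built on $[9,00]$ admits a limit cycle which is reached from every configuration $(\rho,\gamma)$ with $\rho\ge1$; symmetrically, the MBN built on $[20,00]$ admits a limit cycle which is reached from every configuration with $\gamma\ge1$.
   Context: The MBN built on a two-vertex Boolean network $(f_1,f_2)$ with delay vector $(\alpha,\beta)$ of positive integers has configurations $(\rho,\gamma)$ with $0\le\rho\le\alpha$, $0\le\gamma\le\beta$, underlying Boolean state $x=([\rho\ge1],[\gamma\ge1])$, and dynamics: the first coordinate becomes $\alpha$ if $f_1(x)=1$, else $\max(\rho-1,0)$; the second becomes $\beta$ if $f_2(x)=1$, else $\max(\gamma-1,0)$. A limit cycle is a periodic orbit of length $\ge2$; a configuration reaches it if its trajectory eventually enters it. -}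

module Defs where

open import Data.Nat using (ℕ; zero; suc; _≤_; _<_; pred)
open import Data.Bool using (Bool; true; false; not; _∧_; if_then_else_)
open import Data.Product using (_×_; _,_; Σ; ∃; ∃-syntax)
open import Relation.Binary.PropositionalEquality using (_≡_; _≢_)

BN2 : Set
BN2 = (Bool → Bool → Bool) × (Bool → Bool → Bool)

-- Configurations (ρ , γ); the bounds 0 ≤ ρ ≤ α, 0 ≤ γ ≤ β are imposed separately.
Config : Set
Config = ℕ × ℕ

pos : ℕ → Bool
pos zero    = false
pos (suc _) = true

dec : ℕ → ℕ
dec = pred

step : BN2 → ℕ → ℕ → Config → Config
step (f₁ , f₂) α β (ρ , γ) =
  let x₁ = pos ρ ; x₂ = pos γ in
  (if f₁ x₁ x₂ then α else dec ρ) , (if f₂ x₁ x₂ then β else dec γ)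

iterate : ∀ {A : Set} → (A → A) → ℕ → A → A
iterate f zero    a = a
iterate f (suc n) a = f (iterate f n a)

InRange : ℕ → ℕ → Config → Set
InRange α β (ρ , γ) = (ρ ≤ α) × (γ ≤ β)

IsLimitCycle : BN2 → ℕ → ℕ → Config → ℕ → Set
IsLimitCycle F α β c p =
  InRange α β c × (2 ≤ p) × (iterate (step F α β) p c ≡ c)
  × (∀ q → 0 < q → q < p → iterate (step F α β) q c ≢ c)

Reaches : BN2 → ℕ → ℕ → Config → Config → ℕ → Set
Reaches F α β x c p =
  ∃[ n ] ∃[ k ] (k < p × iterate (step F α β) n x ≡ iterate (step F α β) k c)

net9 : BN2
net9 = (λ x₁ x₂ → x₁) , (λ x₁ x₂ → x₁ ∧ not x₂)

net20 : BN2
net20 = (λ x₁ x₂ → not x₁ ∧ x₂) , (λ x₁ x₂ → x₂)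

{-# OPTIONS --safe #-}
module Submission where

open import Defs
open import Data.Nat using (ℕ; zero; suc; _∸_; _≤_; _<_; z≤n; s≤s)
open import Data.Nat.Properties using (≤-refl; <⇒≤; n∸n≡0; m>n⇒m∸n≢0)
open import Data.Product using (_×_; _,_; ∃-syntax; proj₂; swap)
open import Relation.Binary.PropositionalEquality using (_≡_; _≢_; refl; sym; trans; cong; module ≡-Reasoning)

-- For ρ ≥ 1 the network [9,00] keeps resetting ρ to α, while γ runs through the
-- countdown clock 0 ↦ β ↦ β - 1 ↦ … ↦ 1 ↦ 0 of period β + 1, so (α , 0) lies on a
-- limit cycle of length β + 1 that every such trajectory enters after one step.
-- The network [20,00] is [9,00] with its two vertices exchanged, so the second
-- half of the statement is the mirror image of the first.

iterate-suc : ∀ {A : Set} (f : A → A) n a → iterate f (suc n) a ≡ iterate f n (f a)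
iterate-suc f zero    a = refl
iterate-suc f (suc n) a = cong f (iterate-suc f n a)

iterate-conj : ∀ {A B : Set} {f : A → A} {g : B → B} {h : A → B} →
               (∀ x → g (h x) ≡ h (f x)) →
               ∀ n x → iterate g n (h x) ≡ h (iterate f n x)
iterate-conj _ zero x = refl
iterate-conj {f = f} {g} {h} comm (suc n) x = begin
  g (iterate g n (h x))  ≡⟨ cong g (iterate-conj comm n x) ⟩
  g (h (iterate f n x))  ≡⟨ comm (iterate f n x) ⟩
  h (f (iterate f n x))  ∎
  where open ≡-Reasoning

clock : ℕ → ℕ → ℕ
clock β zero    = β
clock β (suc g) = g

iterate-clock : ∀ β {q g} → q ≤ g → iterate (clock β) q g ≡ g ∸ q
iterate-clock β {zero}          _         = refl
iterate-clock β {suc q} {suc g} (s≤s q≤g) =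
  trans (iterate-suc (clock β) q (suc g)) (iterate-clock β q≤g)

clock-runsOut : ∀ β g → iterate (clock β) g g ≡ 0
clock-runsOut β g = trans (iterate-clock β (≤-refl {g})) (n∸n≡0 g)

clock-period : ∀ β → iterate (clock β) (suc β) 0 ≡ 0
clock-period β = trans (iterate-suc (clock β) β 0) (clock-runsOut β β)

clock-aperiodic : ∀ β q → q < β → iterate (clock β) (suc q) 0 ≢ 0
clock-aperiodic β q q<β eq = m>n⇒m∸n≢0 q<β (begin
  β ∸ q                          ≡⟨ iterate-clock β (<⇒≤ q<β) ⟨
  iterate (clock β) q β          ≡⟨ iterate-suc (clock β) q 0 ⟨
  iterate (clock β) (suc q) 0    ≡⟨ eq ⟩
  0                              ∎)
  where open ≡-Reasoning

net9-step : ∀ a β r γ → step net9 (suc a) β (suc r , γ) ≡ (suc a , clock β γ)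
net9-step a β r zero    = refl
net9-step a β r (suc g) = refl

net9-iterate : ∀ a β n γ → iterate (step net9 (suc a) β) n (suc a , γ) ≡ (suc a , iterate (clock β) n γ)
net9-iterate a β = iterate-conj (net9-step a β a)

net9-limitCycle : ∀ a β → 1 ≤ β → IsLimitCycle net9 (suc a) β (suc a , 0) (suc β)
net9-limitCycle a β (s≤s _) = (≤-refl , z≤n) , s≤s (s≤s z≤n) , period , aperiodic
  where
  period : iterate (step net9 (suc a) β) (suc β) (suc a , 0) ≡ (suc a , 0)
  period = trans (net9-iterate a β (suc β) 0) (cong (suc a ,_) (clock-period β))

  aperiodic : ∀ q → 0 < q → q < suc β → iterate (step net9 (suc a) β) q (suc a , 0) ≢ (suc a , 0)
  aperiodic (suc q) _ (s≤s q<β) eq =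
    clock-aperiodic β q q<β (cong proj₂ (trans (sym (net9-iterate a β (suc q) 0)) eq))

net9-reaches : ∀ a β {ρ} γ → 1 ≤ ρ → Reaches net9 (suc a) β (ρ , γ) (suc a , 0) (suc β)
net9-reaches a β {suc r} γ _ = suc (clock β γ) , 0 , s≤s z≤n , (begin
  iterate S (suc (clock β γ)) (suc r , γ)              ≡⟨ iterate-suc S (clock β γ) (suc r , γ) ⟩
  iterate S (clock β γ) (S (suc r , γ))                ≡⟨ cong (iterate S (clock β γ)) (net9-step a β r γ) ⟩
  iterate S (clock β γ) (suc a , clock β γ)            ≡⟨ net9-iterate a β (clock β γ) (clock β γ) ⟩
  (suc a , iterate (clock β) (clock β γ) (clock β γ))  ≡⟨ cong (suc a ,_) (clock-runsOut β (clock β γ)) ⟩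
  (suc a , 0)                                          ∎)
  where
  S = step net9 (suc a) β
  open ≡-Reasoning

net20-mirrors-net9 : ∀ α β c → step net20 α β (swap c) ≡ swap (step net9 β α c)
net20-mirrors-net9 α β (zero  , zero)  = refl
net20-mirrors-net9 α β (zero  , suc _) = refl
net20-mirrors-net9 α β (suc _ , zero)  = refl
net20-mirrors-net9 α β (suc _ , suc _) = refl

module Mirror {F G : BN2} {α β : ℕ}
              (mirror : ∀ c → step G α β (swap c) ≡ swap (step F β α c)) where

  iterate-mirror : ∀ n c → iterate (step G α β) n (swap c) ≡ swap (iterate (step F β α) n c)
  iterate-mirror = iterate-conj mirror

  limitCycle-mirror : ∀ {c p} → IsLimitCycle F β α c p → IsLimitCycle G α β (swap c) p
  limitCycle-mirror {c} {p} ((ρ≤β , γ≤α) , 2≤p , period , aperiodic) =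
    (γ≤α , ρ≤β) , 2≤p , trans (iterate-mirror p c) (cong swap period) ,
    λ q 0<q q<p eq → aperiodic q 0<q q<p (cong swap (trans (sym (iterate-mirror q c)) eq))

  reaches-mirror : ∀ {x c p} → Reaches F β α x c p → Reaches G α β (swap x) (swap c) p
  reaches-mirror {x} {c} (n , k , k<p , eq) =
    n , k , k<p , trans (iterate-mirror n x) (trans (cong swap eq) (sym (iterate-mirror k c)))

proposition6 : (α β : ℕ) → 1 ≤ α → 1 ≤ β →
    (∃[ c ] ∃[ p ] (IsLimitCycle net9 α β c p
        × (∀ ρ γ → 1 ≤ ρ → ρ ≤ α → γ ≤ β → Reaches net9 α β (ρ , γ) c p)))
    × (∃[ c ] ∃[ p ] (IsLimitCycle net20 α β c p
        × (∀ ρ γ → ρ ≤ α → 1 ≤ γ → γ ≤ β → Reaches net20 α β (ρ , γ) c p)))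
proposition6 (suc a) (suc b) 1≤α 1≤β =
    ( (suc a , 0) , suc (suc b)
    , net9-limitCycle a (suc b) 1≤β
    , λ _ γ 1≤ρ _ _ → net9-reaches a (suc b) γ 1≤ρ )
  , ( (0 , suc b) , suc (suc a)
    , limitCycle-mirror (net9-limitCycle b (suc a) 1≤α)
    , λ ρ _ _ 1≤γ _ → reaches-mirror (net9-reaches b (suc a) ρ 1≤γ) )
  where open Mirror {net9} {net20} (net20-mirrors-net9 (suc a) (suc b))
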